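{- Let $a$ be an approximate normal form and $\Pi\triangleright\Gamma\vdash_{\mathcal H} a:\sigma$. For every subderivation of $\Pi$ whose conclusion has the form $\Gamma'\vdash b:\tau$ with $\tau$ a type (not a multiset type), $\tau$ is either a subtype of $\sigma$ or a subtype of $\Gamma$. Moreover, if $a$ is an $\mathcal L$-approximate normal form, then $\sigma$ is a subtype of $\Gamma$.
   Context: Types: $\sigma,\tau,\rho::=\alpha\mid A\to\tau$, $\alpha$ base types, multiset types $A=[\sigma_i]_{i\in I}$ finite possibly empty multisets of types. Environments $\Gamma$ map variables to multiset types, all but finitely many to $[\,]$; $(\Gamma+\Delta)(x)=\Gamma(x)\uplus\Delta(x)$; $\Gamma\setminus x$ sets $x$ to $[\,]$. System $\mathcal H$: (var) $x{:}[\rho]\vdash x:\rho$; ($\to$I) from $\Gamma\vdash t:\tau$ infer $\Gamma\setminus x\vdash\lambda x.t:\Gamma(x)\to\tau$; (m) from $(\Delta_i\vdash t:\sigma_i)_{i\in I}$ ($I$ finite, possibly empty) infer $+_{i\in I}\Delta_i\vdash t:[\sigma_i]_{i\in I}$; ($\to$E) from $\Gamma\vdash t:A\to\tau$ and $\Delta\vdash u:A$ infer $\Gamma+\Delta\vdash tu:\tau$; these rules apply to approximate normal forms, $\Omega$ typable only by (m) with $I=\emptyset$. Approximate normal forms: $a::=\Omega\mid N$, $N::=\lambda x.N\mid L$, $L::=x\mid L\,a$; those generated by $L$ are $\mathcal L$-approximate normal forms. The subtype relation is the transitive closure of: $\sigma$ is a subtype of $\sigma$; $A$ is a subtype of $A$;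 $A$ and $\tau$ are subtypes of $A\to\tau$; each $\sigma_i$ is a subtype of $[\sigma_i]_{i\in I}$. A type is a subtype of $\Gamma$ if it is a subtype of $\Gamma(x)$ for some variable $x$. -}

module Defs where

open import Data.Nat using (ℕ; _≟_)
open import Data.Bool using (if_then_else_)
open import Data.List using (List; []; _∷_; _++_; [_])
open import Data.List.Membership.Propositional using (_∈_)
open import Data.Sum using (_⊎_; inj₁; inj₂)
open import Data.Product using (∃)
open import Relation.Nullary using (does)
open import Relation.Binary.PropositionalEquality using (_≗_)
open import Relation.Binary.Construct.Closure.ReflexiveTransitive using (Star)

Var : Set
Var = ℕ

-- Types  σ ::= α | A → τ ,  multiset types A = [σ_i]_{i∈I}.
-- A finite multiset is represented by a list.
data Ty : Set where
  base : ℕ → Ty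
  _⇒_  : List Ty → Ty → Ty

MTy : Set
MTy = List Ty

Env : Set
Env = Var → MTy

∅ : Env
∅ _ = []

_+ᵉ_ : Env → Env → Env
(Γ +ᵉ Δ) y = Γ y ++ Δ y

_∖_ : Env → Var → Env
(Γ ∖ x) y = if does (y ≟ x) then [] else Γ y

single : Var → Ty → Env
single x ρ y = if does (y ≟ x) then [ ρ ] else []

data Term : Set where
  var : Var → Term
  ƛ   : Var → Term → Term
  _·_ : Term → Term → Term
  Ω   : Term

data IsApprox : Term → Set
data IsN      : Term → Set
data IsL      : Term → Set

data IsApprox where
  Ω-anf : IsApprox Ω
  N-anf : ∀ {t} → IsN t → IsApprox t

data IsN where
  lam-N : ∀ {x t} → IsN t → IsN (ƛ x t)
  L-N   : ∀ {t} → IsL t → IsN t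

data IsL where
  var-L : ∀ {x} → IsL (var x)
  app-L : ∀ {t u} → IsL t → IsApprox u → IsL (t · u)

data _⊢_∶_  : Env → Term → Ty → Set
data _⊢m_∶_ : Env → Term → MTy → Set

data _⊢_∶_ where
  ⊢var : ∀ {Γ x ρ} → Γ ≗ single x ρ → Γ ⊢ var x ∶ ρ
  ⊢lam : ∀ {Γ Γ' x t τ} → Γ ⊢ t ∶ τ → Γ' ≗ (Γ ∖ x) → Γ' ⊢ ƛ x t ∶ (Γ x ⇒ τ)
  ⊢app : ∀ {Γ Δ Θ t u A τ} → Γ ⊢ t ∶ (A ⇒ τ) → Δ ⊢m u ∶ A → Θ ≗ (Γ +ᵉ Δ) →
         Θ ⊢ t · u ∶ τ

data _⊢m_∶_ where
  m-nil  : ∀ {Γ t} → Γ ≗ ∅ → Γ ⊢m t ∶ []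
  m-cons : ∀ {Γ Δ Δ' t σ A} → Δ ⊢ t ∶ σ → Δ' ⊢m t ∶ A → Γ ≗ (Δ +ᵉ Δ') →
           Γ ⊢m t ∶ (σ ∷ A)

data SubD : ∀ {Γ a σ Γ' b τ} → Γ ⊢ a ∶ σ → Γ' ⊢ b ∶ τ → Set
data SubM : ∀ {Γ a A Γ' b τ} → Γ ⊢m a ∶ A → Γ' ⊢ b ∶ τ → Set

data SubD where
  here  : ∀ {Γ a σ} {Π : Γ ⊢ a ∶ σ} → SubD Π Π
  inLam : ∀ {Γ Γ₀ x t τ Γ' b ρ} {P : Γ ⊢ t ∶ τ} {e : Γ₀ ≗ (Γ ∖ x)}
            {Q : Γ' ⊢ b ∶ ρ} → SubD P Q → SubD (⊢lam {x = x} P e) Q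
  inFun : ∀ {Γ Δ Θ t u A τ Γ' b ρ} {P : Γ ⊢ t ∶ (A ⇒ τ)} {M : Δ ⊢m u ∶ A}
            {e : Θ ≗ (Γ +ᵉ Δ)} {Q : Γ' ⊢ b ∶ ρ} → SubD P Q → SubD (⊢app P M e) Q
  inArg : ∀ {Γ Δ Θ t u A τ Γ' b ρ} {P : Γ ⊢ t ∶ (A ⇒ τ)} {M : Δ ⊢m u ∶ A}
            {e : Θ ≗ (Γ +ᵉ Δ)} {Q : Γ' ⊢ b ∶ ρ} → SubM M Q → SubD (⊢app P M e) Q

data SubM where
  inHead : ∀ {Γ Δ Δ' t σ A Γ' b ρ} {P : Δ ⊢ t ∶ σ} {M : Δ' ⊢m t ∶ A}
             {e : Γ ≗ (Δ +ᵉ Δ')} {Q : Γ' ⊢ b ∶ ρ} → SubD P Q → SubM (m-cons P M e) Q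
  inTail : ∀ {Γ Δ Δ' t σ A Γ' b ρ} {P : Δ ⊢ t ∶ σ} {M : Δ' ⊢m t ∶ A}
             {e : Γ ≗ (Δ +ᵉ Δ')} {Q : Γ' ⊢ b ∶ ρ} → SubM M Q → SubM (m-cons P M e) Q

TyOrM : Set
TyOrM = Ty ⊎ MTy

data SubStep : TyOrM → TyOrM → Set where
  dom  : ∀ {A τ} → SubStep (inj₂ A) (inj₁ (A ⇒ τ))
  cod  : ∀ {A τ} → SubStep (inj₁ τ) (inj₁ (A ⇒ τ))
  elem : ∀ {σ A} → σ ∈ A → SubStep (inj₁ σ) (inj₂ A)

_≼_ : TyOrM → TyOrM → Set
_≼_ = Star SubStep

_≼ᵗ_ : Ty → Ty → Set
τ ≼ᵗ σ = inj₁ τ ≼ inj₁ σ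

_≼ᵉ_ : Ty → Env → Set
τ ≼ᵉ Γ = ∃ λ x → inj₁ τ ≼ inj₂ (Γ x)

-- Abstraction puts Γ(x) into the domain of
-- the new type, so whatever lay below Γ(x) now lies below σ.  The head of an
-- L-form is a variable, so the type of an L-form lies below its environment;
-- in an application t u (t an L-form) the argument types sit in the domain
-- of t's type, so every type in the derivation of t or u lies below Γ too.
module Submission where

open import Defs
open import Data.Sum using (_⊎_; inj₁; inj₂; map₁)
open import Data.Product using (_×_; _,_; ∃)
open import Data.Nat using (_≟_)
open import Data.List using ([]; _∷_)
open import Data.List.Membership.Propositional using (_∈_)
open import Data.List.Relation.Unary.Any using (here; there)
open import Data.List.Relation.Binary.Subset.Propositional using (_⊆_)
open import Data.List.Relation.Binary.Subset.Propositional.Properties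
  using (⊆-reflexive; ⊆-trans; xs⊆xs++ys; xs⊆ys++xs)
open import Relation.Nullary using (yes; no; ¬_)
open import Relation.Nullary.Decidable using (dec-true; dec-false)
open import Relation.Binary.PropositionalEquality
  using (_≡_; refl; sym; trans; _≗_)
open import Relation.Binary.Construct.Closure.ReflexiveTransitive using (ε; _◅_; _◅◅_)

≼-into-multiset : ∀ {τ A} → inj₁ τ ≼ inj₂ A → ∃ λ σ → σ ∈ A × τ ≼ᵗ σ
≼-into-multiset (cod ◅ p) with ≼-into-multiset p
... | σ , σ∈A , q = σ , σ∈A , cod ◅ q
≼-into-multiset (elem τ∈A ◅ ε) = _ , τ∈A , ε
≼-into-multiset (elem τ∈B ◅ dom ◅ p) with ≼-into-multiset p
... | σ , σ∈A , q = σ , σ∈A , elem τ∈B ◅ dom ◅ q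

≼-⊆ : ∀ {τ A B} → A ⊆ B → inj₁ τ ≼ inj₂ A → inj₁ τ ≼ inj₂ B
≼-⊆ A⊆B p with ≼-into-multiset p
... | σ , σ∈A , q = q ◅◅ elem (A⊆B σ∈A) ◅ ε

≼ᵗ-≼ᵉ-trans : ∀ {τ σ Γ} → τ ≼ᵗ σ → σ ≼ᵉ Γ → τ ≼ᵉ Γ
≼ᵗ-≼ᵉ-trans p (x , q) = x , p ◅◅ q

≼ᵗ⊎≼ᵉ⇒≼ᵉ : ∀ {τ σ Γ} → (τ ≼ᵗ σ) ⊎ (τ ≼ᵉ Γ) → σ ≼ᵉ Γ → τ ≼ᵉ Γ
≼ᵗ⊎≼ᵉ⇒≼ᵉ (inj₁ p) q = ≼ᵗ-≼ᵉ-trans p q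
≼ᵗ⊎≼ᵉ⇒≼ᵉ (inj₂ p) _ = p

_⊆ᵉ_ : Env → Env → Set
Γ ⊆ᵉ Θ = ∀ y → Γ y ⊆ Θ y

≼ᵉ-⊆ᵉ : ∀ {τ Γ Θ} → Γ ⊆ᵉ Θ → τ ≼ᵉ Γ → τ ≼ᵉ Θ
≼ᵉ-⊆ᵉ Γ⊆Θ (y , p) = y , ≼-⊆ (Γ⊆Θ y) p

+ᵉ-⊆ᵉˡ : ∀ {Θ Γ Δ} → Θ ≗ (Γ +ᵉ Δ) → Γ ⊆ᵉ Θ
+ᵉ-⊆ᵉˡ {Γ = Γ} {Δ} e y = ⊆-trans (xs⊆xs++ys (Γ y) (Δ y)) (⊆-reflexive (sym (e y)))

+ᵉ-⊆ᵉʳ : ∀ {Θ Γ Δ} → Θ ≗ (Γ +ᵉ Δ) → Δ ⊆ᵉ Θ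
+ᵉ-⊆ᵉʳ {Γ = Γ} {Δ} e y = ⊆-trans (xs⊆ys++xs (Δ y) (Γ y)) (⊆-reflexive (sym (e y)))

single-self : ∀ x ρ → single x ρ x ≡ ρ ∷ []
single-self x ρ rewrite dec-true (x ≟ x) refl = refl

∖-≢ : ∀ (Γ : Env) {x y} → ¬ y ≡ x → (Γ ∖ x) y ≡ Γ y
∖-≢ Γ {x} {y} y≢x rewrite dec-false (y ≟ x) y≢x = refl

≼ᵉ-∖ : ∀ {τ Γ Γ' x} → Γ' ≗ (Γ ∖ x) → τ ≼ᵉ Γ → (inj₁ τ ≼ inj₂ (Γ x)) ⊎ (τ ≼ᵉ Γ')
≼ᵉ-∖ {Γ = Γ} {x = x} e (y , p) with y ≟ x
... | yes refl = inj₁ p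
... | no y≢x = inj₂ (y , ≼-⊆ (⊆-reflexive (sym (trans (e y) (∖-≢ Γ y≢x)))) p)

IsL⇒≼ᵉ : ∀ {Γ a σ} → IsL a → Γ ⊢ a ∶ σ → σ ≼ᵉ Γ
IsL⇒≼ᵉ var-L (⊢var {x = x} e) =
  x , ≼-⊆ (⊆-reflexive (sym (trans (e x) (single-self x _)))) (elem (here refl) ◅ ε)
IsL⇒≼ᵉ (app-L t _) (⊢app P _ e) = ≼ᵉ-⊆ᵉ (+ᵉ-⊆ᵉˡ e) (≼ᵗ-≼ᵉ-trans (cod ◅ ε) (IsL⇒≼ᵉ t P))

IsApprox-ƛ⁻¹ : ∀ {x t} → IsApprox (ƛ x t) → IsApprox t
IsApprox-ƛ⁻¹ (N-anf (lam-N t)) = N-anf t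

IsApprox-·⁻¹ : ∀ {t u} → IsApprox (t · u) → IsL t × IsApprox u
IsApprox-·⁻¹ (N-anf (L-N (app-L t u))) = t , u

mutual
  SubD⇒≼ : ∀ {Γ a σ Γ' b τ} {Π : Γ ⊢ a ∶ σ} {Π' : Γ' ⊢ b ∶ τ} →
           IsApprox a → SubD Π Π' → (τ ≼ᵗ σ) ⊎ (τ ≼ᵉ Γ)
  SubD⇒≼ _ here = inj₁ ε
  SubD⇒≼ a (inLam {e = e} s) with SubD⇒≼ (IsApprox-ƛ⁻¹ a) s
  ... | inj₁ p = inj₁ (p ◅◅ cod ◅ ε)
  ... | inj₂ p = map₁ (λ q → q ◅◅ dom ◅ ε) (≼ᵉ-∖ e p)
  SubD⇒≼ a (inFun {P = P} {e = e} s) with IsApprox-·⁻¹ a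
  ... | t , _ =
    inj₂ (≼ᵉ-⊆ᵉ (+ᵉ-⊆ᵉˡ e) (≼ᵗ⊎≼ᵉ⇒≼ᵉ (SubD⇒≼ (N-anf (L-N t)) s) (IsL⇒≼ᵉ t P)))
  SubD⇒≼ a (inArg {P = P} {e = e} s) with IsApprox-·⁻¹ a
  ... | t , u with SubM⇒≼ u s
  ...   | inj₁ p = inj₂ (≼ᵉ-⊆ᵉ (+ᵉ-⊆ᵉˡ e) (≼ᵗ-≼ᵉ-trans (p ◅◅ dom ◅ ε) (IsL⇒≼ᵉ t P)))
  ...   | inj₂ p = inj₂ (≼ᵉ-⊆ᵉ (+ᵉ-⊆ᵉʳ e) p)

  SubM⇒≼ : ∀ {Δ a A Γ' b τ} {M : Δ ⊢m a ∶ A} {Π' : Γ' ⊢ b ∶ τ} →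
           IsApprox a → SubM M Π' → (inj₁ τ ≼ inj₂ A) ⊎ (τ ≼ᵉ Δ)
  SubM⇒≼ a (inHead {e = e} s) with SubD⇒≼ a s
  ... | inj₁ p = inj₁ (p ◅◅ elem (here refl) ◅ ε)
  ... | inj₂ p = inj₂ (≼ᵉ-⊆ᵉ (+ᵉ-⊆ᵉˡ e) p)
  SubM⇒≼ a (inTail {e = e} s) with SubM⇒≼ a s
  ... | inj₁ p = inj₁ (≼-⊆ there p)
  ... | inj₂ p = inj₂ (≼ᵉ-⊆ᵉ (+ᵉ-⊆ᵉʳ e) p)

lemma3p11 : ∀ {Γ a σ} → IsApprox a → (Π : Γ ⊢ a ∶ σ) →
    ((∀ {Γ' b τ} (Π' : Γ' ⊢ b ∶ τ) → SubD Π Π' → (τ ≼ᵗ σ) ⊎ (τ ≼ᵉ Γ))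
    × (IsL a → σ ≼ᵉ Γ))
lemma3p11 a Π = (λ _ → SubD⇒≼ a) , (λ t → IsL⇒≼ᵉ t Π)
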